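{- For all $b\in\mathbb{F}_p$ and $c\in\mathbb{F}_p^*$, the tiling $H_{b,c}$ is nonperiodic: there is no nonzero vector $x$ with $H_{b,c}+x=H_{b,c}$ (as a decorated tiling).
   Context: Let $p$ be an odd prime, $\mathbb{F}_p$ the field with $p$ elements, $\mathbb{F}_p^*=\mathbb{F}_p\setminus\{0\}$. A tile is a unit equilateral triangle of the standard triangular lattice in the plane, oriented upward or downward, whose corners are decorated with elements of $\mathbb{F}_p$. $\triangle(x,y,z)$ is the upward tile with bottom-left, bottom-right, top corners $x,y,z$; $\triangledown(x,y,z)$ the downward tile with top-right, top-left, bottom corners $x,y,z$. The substitution $\sigma$ inflates a tile by factor $2$ and replaces it by four unit tiles: $\sigma(\triangle(x,y,z))$ consists of bottom-left $\triangle(x,x+y,x+z)$, bottom-right $\triangle(x+y,y,y+z)$, top $\triangle(x+z,y+z,z)$ and central $\triangledown(y+z,x+z,x+y)$; $\sigma(\triangledown(x,y,z))$ consists of top-right $\triangledown(x,x+y,x+z)$, top-left $\triangledown(x+y,y,y+z)$, bottom $\triangledown(x+z,y+z,z)$ and central $\triangle(y+z,x+z,x+y)$. $\sigma$ acts on patches tile by tile, with inflation about a fixed point. For $b\in\mathbb{F}_p$, $c\in\mathbb{F}_p^*$, let $h_{b,c}$ be the hexagonal patch of the six unit tiles sharing a common vertex $v$ (placed at the origin), decorated with $c$ at $v$ and $b$ at each of the six other vertices. Let $h_{b,c}(k)=\sigma^{kp}(h_{b,c})$ with inflation by $2^{kp}$ about $v$. The patches $h_{b,c}(k)$ are nested and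 their union is a decorated tiling of the plane denoted $H_{b,c}$. -}

module Defs where

open import Data.Nat as ℕ using (ℕ; NonZero; _*_)
open import Data.Nat.DivMod using (_mod_)
open import Data.Fin using (Fin; toℕ)
open import Data.Integer as ℤ using (ℤ; +_)
open import Data.Product using (_×_; _,_; Σ)
open import Data.List using (List; []; _∷_; concatMap)
open import Data.List.Membership.Propositional using (_∈_)
open import Function using (_∘_)

𝔽 : ℕ → Set
𝔽 p = Fin p

module _ (p : ℕ) .{{_ : NonZero p}} where

  infixl 6 _⊕_
  _⊕_ : 𝔽 p → 𝔽 p → 𝔽 p
  x ⊕ y = (toℕ x ℕ.+ toℕ y) mod p

-- Triangular lattice: vertex (i , j) ∈ ℤ² sits at i·e₁ + j·e₂ with
-- e₁ = (1,0), e₂ = (1/2, √3/2).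
-- up   tile at (i,j): corners bottom-left (i,j), bottom-right (i+1,j), top (i,j+1)
-- down tile at (i,j): corners top-right (i+1,j+1), top-left (i,j+1), bottom (i+1,j)
data Orient : Set where
  up down : Orient

-- A decorated tile: orientation, lattice position, and corner decorations.
-- For up: (bottom-left , bottom-right , top); for down: (top-right , top-left , bottom).
record Tile (p : ℕ) : Set where
  constructor tile
  field
    orient : Orient
    pos    : ℤ × ℤ
    deco   : 𝔽 p × 𝔽 p × 𝔽 p

Patch : ℕ → Set
Patch p = List (Tile p)

△ : ∀ {p} → ℤ → ℤ → 𝔽 p → 𝔽 p → 𝔽 p → Tile p
△ i j x y z = tile up (i , j) (x , y , z)

▽ : ∀ {p} → ℤ → ℤ → 𝔽 p → 𝔽 p → 𝔽 p → Tile p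
▽ i j x y z = tile down (i , j) (x , y , z)

module _ (p : ℕ) .{{_ : NonZero p}} where

  private
    _+ₚ_ = _⊕_ p
    infixl 6 _+ₚ_
    dbl : ℤ → ℤ
    dbl i = + 2 ℤ.* i
    s : ℤ → ℤ
    s i = ℤ.suc (dbl i)

  σTile : Tile p → Patch p
  σTile (tile up (i , j) (x , y , z)) =
      △ (dbl i) (dbl j) x (x +ₚ y) (x +ₚ z)
    ∷ △ (s i)   (dbl j) (x +ₚ y) y (y +ₚ z)
    ∷ △ (dbl i) (s j)   (x +ₚ z) (y +ₚ z) z
    ∷ ▽ (dbl i) (dbl j) (y +ₚ z) (x +ₚ z) (x +ₚ y)
    ∷ []
  σTile (tile down (i , j) (x , y , z)) =
      ▽ (s i)   (s j)   x (x +ₚ y) (x +ₚ z)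
    ∷ ▽ (dbl i) (s j)   (x +ₚ y) y (y +ₚ z)
    ∷ ▽ (s i)   (dbl j) (x +ₚ z) (y +ₚ z) z
    ∷ △ (s i)   (s j)   (y +ₚ z) (x +ₚ z) (x +ₚ y)
    ∷ []

  σ : Patch p → Patch p
  σ = concatMap σTile

  σ^ : ℕ → Patch p → Patch p
  σ^ ℕ.zero P = P
  σ^ (ℕ.suc n) P = σ (σ^ n P)

  -- The hexagonal patch h_{b,c}: the six unit tiles around the origin v,
  -- decorated with c at v and b at the six other vertices.
  hex : 𝔽 p → 𝔽 p → Patch p
  hex b c =
      △ (+ 0) (+ 0) c b b
    ∷ △ (ℤ.- (+ 1)) (+ 0) b c b
    ∷ △ (+ 0) (ℤ.- (+ 1)) b b c
    ∷ ▽ (ℤ.- (+ 1)) (+ 0) b b c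
    ∷ ▽ (ℤ.- (+ 1)) (ℤ.- (+ 1)) c b b
    ∷ ▽ (+ 0) (ℤ.- (+ 1)) b c b
    ∷ []

  hexPatch : 𝔽 p → 𝔽 p → ℕ → Patch p
  hexPatch b c k = σ^ (k * p) (hex b c)

  _∈H[_,_] : Tile p → 𝔽 p → 𝔽 p → Set
  t ∈H[ b , c ] = Σ ℕ (λ k → t ∈ hexPatch b c k)

translate : ∀ {p} → ℤ × ℤ → Tile p → Tile p
translate (a , b) (tile o (i , j) d) = tile o (i ℤ.+ a , j ℤ.+ b) d

-- A nonzero period x of H_{b,c} is also a period of every deflation σ⁻ⁿ(H_{b,c}), because
-- the substitution is recognizable: the corner child of a tile determines the tile. Halving
-- an even period at each deflation step strictly shrinks it, so some level n carries a period
-- with an odd coordinate. Such a period moves a tile of the central hexagon onto a child of a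
-- tile Q, and moves a sibling of that child back onto the central hexagon. In σ⁻ⁿ(H) the
-- origin is decorated c and its six neighbours by r ≡ b - n c (mod p), and the sibling
-- relation forces c = r + r. The same holds at level n + 1, so p divides 2c: impossible for
-- an odd prime p and c ≢ 0.
module Submission where

open import Data.Bool using (Bool; true; false)
open import Data.Empty using (⊥; ⊥-elim)
open import Data.Fin using (toℕ)
import Data.Fin.Properties as Fin
open import Data.Integer as ℤ using (ℤ; +_; -[1+_])
import Data.Integer.Properties as ℤ
open import Data.Integer.DivMod using (_%ℕ_; _/ℕ_; a≡a%ℕn+[a/ℕn]*n; n%ℕd<d)
open import Data.Integer.Divisibility.Signed
  using (_∣_; divides; ∣⇒∣ᵤ; ∣m∣n⇒∣m+n; ∣n⇒∣m*n; ∣m⇒∣m*n; ∣m⇒∣-m)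
open import Data.Integer.Tactic.RingSolver using (solve-∀)
open import Data.List using (List; []; _∷_; map)
open import Data.List.Membership.Propositional using (_∈_; find; lose)
open import Data.List.Membership.Propositional.Properties using (∈-map⁻; ∈-map⁺; ∈-concatMap⁻; ∈-concatMap⁺)
open import Data.List.Relation.Binary.Subset.Propositional using (_⊆_)
open import Data.List.Relation.Binary.Subset.Propositional.Properties using (concatMap⁺)
open import Data.List.Relation.Unary.Any using (here; there)
open import Data.Nat as ℕ using (ℕ; NonZero; zero; suc)
open import Data.Nat.DivMod using (_mod_; _divMod_; DivMod)
open import Data.Nat.Divisibility as ℕ∣ using (>⇒∤)
open import Data.Nat.Induction using (<-wellFounded)
open import Data.Nat.Primality using (Prime; euclidsLemma; prime⇒nonTrivial)
import Data.Nat.Properties as ℕ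
open import Data.Product using (_×_; _,_; ∃; ∃₂; proj₁; proj₂)
open import Data.Sum using (inj₁; inj₂)
open import Function using (_∘_; id; case_of_)
open import Induction.WellFounded using (Acc; acc)
open import Relation.Binary.PropositionalEquality
open import Relation.Nullary using (¬_)

open import Defs

appendBit : ℤ → Bool → ℤ
appendBit i false = + 2 ℤ.* i
appendBit i true  = + 1 ℤ.+ + 2 ℤ.* i

appendBit-surjective : ∀ z → ∃₂ λ u δ → z ≡ appendBit u δ
appendBit-surjective z with z %ℕ 2 | n%ℕd<d z 2 | a≡a%ℕn+[a/ℕn]*n z 2
... | 0 | _ | e = z /ℕ 2 , false , trans e (lemma (z /ℕ 2))
  where lemma : ∀ u → + 0 ℤ.+ u ℤ.* + 2 ≡ + 2 ℤ.* u
        lemma = solve-∀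
... | 1 | _ | e = z /ℕ 2 , true , trans e (lemma (z /ℕ 2))
  where lemma : ∀ u → + 1 ℤ.+ u ℤ.* + 2 ≡ + 1 ℤ.+ + 2 ℤ.* u
        lemma = solve-∀
... | suc (suc _) | ℕ.s≤s (ℕ.s≤s ()) | _

odd≢even : ∀ u v → appendBit u true ≢ appendBit v false
odd≢even u v e = 1≢2* ℤ.∣ v ℤ.- u ∣ (trans (cong ℤ.∣_∣ 1≡2[v-u]) (ℤ.abs-* (+ 2) (v ℤ.- u)))
  where
  1≡2[v-u] : + 1 ≡ + 2 ℤ.* (v ℤ.- u)
  1≡2[v-u] = trans (cancel u) (trans (cong (ℤ._- + 2 ℤ.* u) e) (factor u v))
    where
    cancel : ∀ u → + 1 ≡ (+ 1 ℤ.+ + 2 ℤ.* u) ℤ.- + 2 ℤ.* u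
    cancel = solve-∀
    factor : ∀ u v → + 2 ℤ.* v ℤ.- + 2 ℤ.* u ≡ + 2 ℤ.* (v ℤ.- u)
    factor = solve-∀
  1≢2* : ∀ n → 1 ≢ 2 ℕ.* n
  1≢2* zero ()
  1≢2* (suc n) e = ℕ.1+n≢0 (sym (ℕ.suc-injective (trans e (ℕ.*-suc 2 n))))

appendBit-injective : ∀ {u v δ δ'} → appendBit u δ ≡ appendBit v δ' → u ≡ v × δ ≡ δ'
appendBit-injective {u} {v} {false} {false} e = ℤ.*-cancelˡ-≡ (+ 2) u v e , refl
appendBit-injective {u} {v} {true}  {true}  e =
  ℤ.*-cancelˡ-≡ (+ 2) u v (trans (sym (ℤ.pred-suc _)) (trans (cong ℤ.pred e) (ℤ.pred-suc _))) , refl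
appendBit-injective {u} {v} {true}  {false} e = ⊥-elim (odd≢even u v e)
appendBit-injective {u} {v} {false} {true}  e = ⊥-elim (odd≢even v u (sym e))

appendBit-+ : ∀ i a δ → appendBit (i ℤ.+ a) δ ≡ appendBit i δ ℤ.+ + 2 ℤ.* a
appendBit-+ i a false = lemma i a
  where lemma : ∀ i a → + 2 ℤ.* (i ℤ.+ a) ≡ + 2 ℤ.* i ℤ.+ + 2 ℤ.* a
        lemma = solve-∀
appendBit-+ i a true  = lemma i a
  where lemma : ∀ i a → + 1 ℤ.+ + 2 ℤ.* (i ℤ.+ a) ≡ + 1 ℤ.+ + 2 ℤ.* i ℤ.+ + 2 ℤ.* a
        lemma = solve-∀

-1+odd : ∀ u → ℤ.- + 1 ℤ.+ appendBit u true ≡ appendBit u false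
-1+odd u = lemma u
  where lemma : ∀ u → ℤ.- + 1 ℤ.+ (+ 1 ℤ.+ + 2 ℤ.* u) ≡ + 2 ℤ.* u
        lemma = solve-∀

even-odd : ∀ v → appendBit v false ℤ.+ ℤ.- appendBit v true ≡ ℤ.- + 1
even-odd v = lemma v
  where lemma : ∀ v → + 2 ℤ.* v ℤ.+ ℤ.- (+ 1 ℤ.+ + 2 ℤ.* v) ≡ ℤ.- + 1
        lemma = solve-∀

double : ℤ × ℤ → ℤ × ℤ
double (a , a') = + 2 ℤ.* a , + 2 ℤ.* a'

neg : ℤ × ℤ → ℤ × ℤ
neg (a , a') = ℤ.- a , ℤ.- a'

translate-twice : ∀ {p} x (t : Tile p) → translate x (translate x t) ≡ translate (double x) t
translate-twice (a , a') (tile o (i , j) d) = cong (λ q → tile o q d) (cong₂ _,_ (lemma i a) (lemma j a'))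
  where lemma : ∀ i a → i ℤ.+ a ℤ.+ a ≡ i ℤ.+ + 2 ℤ.* a
        lemma = solve-∀

translate-neg : ∀ {p} x (t : Tile p) → translate x (translate (neg x) t) ≡ t
translate-neg (a , a') (tile o (i , j) d) = cong (λ q → tile o q d) (cong₂ _,_ (lemma i a) (lemma j a'))
  where lemma : ∀ i a → i ℤ.+ ℤ.- a ℤ.+ a ≡ i
        lemma = solve-∀

size : ℤ × ℤ → ℕ
size (a , a') = ℤ.∣ a ∣ ℕ.+ ℤ.∣ a' ∣

size-double : ∀ x → size (double x) ≡ size x ℕ.* 2
size-double (a , a') = begin
  ℤ.∣ + 2 ℤ.* a ∣ ℕ.+ ℤ.∣ + 2 ℤ.* a' ∣ ≡⟨ cong₂ ℕ._+_ (ℤ.abs-* (+ 2) a) (ℤ.abs-* (+ 2) a') ⟩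
  2 ℕ.* ℤ.∣ a ∣ ℕ.+ 2 ℕ.* ℤ.∣ a' ∣     ≡⟨ sym (ℕ.*-distribˡ-+ 2 ℤ.∣ a ∣ ℤ.∣ a' ∣) ⟩
  2 ℕ.* size (a , a')                  ≡⟨ ℕ.*-comm 2 (size (a , a')) ⟩
  size (a , a') ℕ.* 2                  ∎
  where open ≡-Reasoning

size-<-double : ∀ {x} → x ≢ (+ 0 , + 0) → size x ℕ.< size (double x)
size-<-double {a , a'} x≢0 = subst (size (a , a') ℕ.<_) (sym (size-double (a , a')))
  (ℕ.m<m*n (size (a , a')) 2 {{ℕ.≢-nonZero size≢0}} (ℕ.s≤s (ℕ.s≤s ℕ.z≤n)))
  where
  size≢0 : size (a , a') ≢ 0
  size≢0 e = x≢0 (cong₂ _,_ (ℤ.∣i∣≡0⇒i≡0 (ℕ.m+n≡0⇒m≡0 _ e)) (ℤ.∣i∣≡0⇒i≡0 (ℕ.m+n≡0⇒n≡0 _ e)))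

neg-double : ∀ x → neg (double x) ≡ double (neg x)
neg-double (a , a') = cong₂ _,_ (lemma a) (lemma a')
  where lemma : ∀ a → ℤ.- (+ 2 ℤ.* a) ≡ + 2 ℤ.* ℤ.- a
        lemma = solve-∀

data SubTile : Set where
  corner₁ corner₂ corner₃ centre : SubTile

subTiles : List SubTile
subTiles = corner₁ ∷ corner₂ ∷ corner₃ ∷ centre ∷ []

opposite : Orient → Orient
opposite up   = down
opposite down = up

childOrient : Orient → SubTile → Orient
childOrient o centre = opposite o
childOrient o _      = o

-- The child k of a tile at (i , j) lies at (2i + δ₁ , 2j + δ₂) where (δ₁ , δ₂) = childOffset o k.
childOffset : Orient → SubTile → Bool × Bool
childOffset up   corner₁ = false , false
childOffset up   corner₂ = true  , false
childOffset up   corner₃ = false , true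
childOffset up   centre  = false , false
childOffset down corner₁ = true  , true
childOffset down corner₂ = false , true
childOffset down corner₃ = true  , false
childOffset down centre  = true  , true

childShape : Orient → SubTile → Orient × Bool × Bool
childShape o k = childOrient o k , childOffset o k

-- The orientation of a child and the parities of its position determine the orientation of its
-- parent and which child it is.
childShape⁻¹ : Orient × Bool × Bool → Orient × SubTile
childShape⁻¹ (up   , false , false) = up   , corner₁
childShape⁻¹ (up   , true  , false) = up   , corner₂
childShape⁻¹ (up   , false , true)  = up   , corner₃
childShape⁻¹ (down , false , false) = up   , centre
childShape⁻¹ (down , true  , true)  = down , corner₁
childShape⁻¹ (down , false , true)  = down , corner₂
childShape⁻¹ (down , true  , false) = down , corner₃
childShape⁻¹ (up   , true  , true)  = down , centre

childShape⁻¹-childShape : ∀ o k → childShape⁻¹ (childShape o k) ≡ (o , k)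
childShape⁻¹-childShape up   corner₁ = refl
childShape⁻¹-childShape up   corner₂ = refl
childShape⁻¹-childShape up   corner₃ = refl
childShape⁻¹-childShape up   centre  = refl
childShape⁻¹-childShape down corner₁ = refl
childShape⁻¹-childShape down corner₂ = refl
childShape⁻¹-childShape down corner₃ = refl
childShape⁻¹-childShape down centre  = refl

place : ∀ {p} → Tile p → Orient × ℤ × ℤ
place t = Tile.orient t , Tile.pos t

tile-≡ : ∀ {p} {t t' : Tile p} → place t ≡ place t' → Tile.deco t ≡ Tile.deco t' → t ≡ t'
tile-≡ {t = tile _ _ _} {tile _ _ _} refl refl = refl

∣∧<⇒≡0 : ∀ {m d} → m ℕ∣.∣ d → d ℕ.< m → d ≡ 0
∣∧<⇒≡0 {d = zero}  _   _   = refl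
∣∧<⇒≡0 {d = suc _} m∣d d<m = ⊥-elim (>⇒∤ d<m m∣d)

module Substitution (p : ℕ) .{{_ : NonZero p}} where

  infixl 6 _+ₚ_
  _+ₚ_ : 𝔽 p → 𝔽 p → 𝔽 p
  _+ₚ_ = _⊕_ p

  ⟦_⟧ : 𝔽 p → ℤ
  ⟦ x ⟧ = + toℕ x

  +ₚ-comm : ∀ x y → x +ₚ y ≡ y +ₚ x
  +ₚ-comm x y = cong (_mod p) (ℕ.+-comm (toℕ x) (toℕ y))

  +ₚ-sound : ∀ x y → + p ∣ ⟦ x ⟧ ℤ.+ ⟦ y ⟧ ℤ.- ⟦ x +ₚ y ⟧
  +ₚ-sound x y = divides (+ q) (begin
    ⟦ x ⟧ ℤ.+ ⟦ y ⟧ ℤ.- ⟦ x +ₚ y ⟧              ≡⟨ cong (ℤ._- ⟦ x +ₚ y ⟧) (sym (ℤ.pos-+ (toℕ x) (toℕ y))) ⟩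
    + (toℕ x ℕ.+ toℕ y) ℤ.- ⟦ x +ₚ y ⟧          ≡⟨ cong (λ m → + m ℤ.- ⟦ x +ₚ y ⟧) (DivMod.property ((toℕ x ℕ.+ toℕ y) divMod p)) ⟩
    + (toℕ (x +ₚ y) ℕ.+ q ℕ.* p) ℤ.- ⟦ x +ₚ y ⟧ ≡⟨ cong (ℤ._- ⟦ x +ₚ y ⟧) (ℤ.pos-+ (toℕ (x +ₚ y)) (q ℕ.* p)) ⟩
    ⟦ x +ₚ y ⟧ ℤ.+ + (q ℕ.* p) ℤ.- ⟦ x +ₚ y ⟧   ≡⟨ cong (λ m → ⟦ x +ₚ y ⟧ ℤ.+ m ℤ.- ⟦ x +ₚ y ⟧) (ℤ.pos-* q p) ⟩
    ⟦ x +ₚ y ⟧ ℤ.+ + q ℤ.* + p ℤ.- ⟦ x +ₚ y ⟧   ≡⟨ cancel ⟦ x +ₚ y ⟧ (+ q ℤ.* + p) ⟩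
    + q ℤ.* + p                                  ∎)
    where
    open ≡-Reasoning
    q = DivMod.quotient ((toℕ x ℕ.+ toℕ y) divMod p)
    cancel : ∀ r m → r ℤ.+ m ℤ.- r ≡ m
    cancel = solve-∀

  residue-injective-≤ : ∀ {x y} → toℕ x ℕ.≤ toℕ y → + p ∣ ⟦ x ⟧ ℤ.- ⟦ y ⟧ → x ≡ y
  residue-injective-≤ {x} {y} x≤y p∣x-y = Fin.toℕ-injective (ℕ.≤-antisym x≤y (ℕ.m∸n≡0⇒m≤n gap≡0))
    where
    p∣gap : p ℕ∣.∣ toℕ y ℕ.∸ toℕ x
    p∣gap = subst (p ℕ∣.∣_) (ℤ.∣⊖∣-≤ x≤y) (∣⇒∣ᵤ (subst (+ p ∣_) (ℤ.m-n≡m⊖n (toℕ x) (toℕ y)) p∣x-y))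
    gap≡0 : toℕ y ℕ.∸ toℕ x ≡ 0
    gap≡0 = ∣∧<⇒≡0 p∣gap (ℕ.≤-<-trans (ℕ.m∸n≤m (toℕ y) (toℕ x)) (Fin.toℕ<n y))

  residue-injective : ∀ {x y} → + p ∣ ⟦ x ⟧ ℤ.- ⟦ y ⟧ → x ≡ y
  residue-injective {x} {y} p∣x-y with ℕ.≤-total (toℕ x) (toℕ y)
  ... | inj₁ x≤y = residue-injective-≤ x≤y p∣x-y
  ... | inj₂ y≤x = sym (residue-injective-≤ y≤x (subst (+ p ∣_) (negate ⟦ x ⟧ ⟦ y ⟧) (∣m⇒∣-m p∣x-y)))
    where
    negate : ∀ i j → ℤ.- (i ℤ.- j) ≡ j ℤ.- i
    negate = solve-∀

  +ₚ-cancelˡ : ∀ x {y y'} → x +ₚ y ≡ x +ₚ y' → y ≡ y'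
  +ₚ-cancelˡ x {y} {y'} e = residue-injective (subst (+ p ∣_) (combine ⟦ x ⟧ ⟦ y ⟧ ⟦ y' ⟧ ⟦ x +ₚ y ⟧)
    (∣m∣n⇒∣m+n (+ₚ-sound x y) (∣m⇒∣-m (subst (λ s → + p ∣ ⟦ x ⟧ ℤ.+ ⟦ y' ⟧ ℤ.- ⟦ s ⟧) (sym e) (+ₚ-sound x y')))))
    where
    combine : ∀ x y y' s → x ℤ.+ y ℤ.- s ℤ.+ ℤ.- (x ℤ.+ y' ℤ.- s) ≡ y ℤ.- y'
    combine = solve-∀

  odd-prime∤2x : Prime p → p ≢ 2 → ∀ x → toℕ x ≢ 0 → ¬ (+ p ∣ + 2 ℤ.* ⟦ x ⟧)
  odd-prime∤2x p-prime p≢2 x x≢0 p∣2x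
    with euclidsLemma 2 (toℕ x) p-prime (subst (p ℕ∣.∣_) (ℤ.abs-* (+ 2) ⟦ x ⟧) (∣⇒∣ᵤ p∣2x))
  ... | inj₁ p∣2 = p≢2 (ℕ.≤-antisym (ℕ∣.∣⇒≤ p∣2) (ℕ.nonTrivial⇒n>1 p {{prime⇒nonTrivial p-prime}}))
  ... | inj₂ p∣x = >⇒∤ {{ℕ.≢-nonZero x≢0}} (Fin.toℕ<n x) p∣x

  childDeco : SubTile → 𝔽 p × 𝔽 p × 𝔽 p → 𝔽 p × 𝔽 p × 𝔽 p
  childDeco corner₁ (x , y , z) = x , x +ₚ y , x +ₚ z
  childDeco corner₂ (x , y , z) = x +ₚ y , y , y +ₚ z
  childDeco corner₃ (x , y , z) = x +ₚ z , y +ₚ z , z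
  childDeco centre  (x , y , z) = y +ₚ z , x +ₚ z , x +ₚ y

  child : SubTile → Tile p → Tile p
  child k (tile o (i , j) d) =
    tile (childOrient o k) (appendBit i (proj₁ (childOffset o k)) , appendBit j (proj₂ (childOffset o k))) (childDeco k d)

  σTile-children : ∀ Q → σTile p Q ≡ map (λ k → child k Q) subTiles
  σTile-children (tile up   _ _) = refl
  σTile-children (tile down _ _) = refl

  ∈σTile⁻ : ∀ {t Q} → t ∈ σTile p Q → ∃ λ k → t ≡ child k Q
  ∈σTile⁻ {Q = Q} t∈ with ∈-map⁻ (λ k → child k Q) (subst (_ ∈_) (σTile-children Q) t∈)
  ... | k , _ , e = k , e

  ∈σTile⁺ : ∀ k Q → child k Q ∈ σTile p Q
  ∈σTile⁺ k Q = subst (child k Q ∈_) (sym (σTile-children Q)) (∈-map⁺ (λ k → child k Q) (k∈subTiles k))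
    where
    k∈subTiles : ∀ k → k ∈ subTiles
    k∈subTiles corner₁ = here refl
    k∈subTiles corner₂ = there (here refl)
    k∈subTiles corner₃ = there (there (here refl))
    k∈subTiles centre  = there (there (there (here refl)))

  ∈σ⁻ : ∀ {t P} → t ∈ σ p P → ∃₂ λ Q k → Q ∈ P × t ≡ child k Q
  ∈σ⁻ t∈ with find (∈-concatMap⁻ (σTile p) t∈)
  ... | Q , Q∈ , t∈σQ = Q , proj₁ (∈σTile⁻ t∈σQ) , Q∈ , proj₂ (∈σTile⁻ t∈σQ)

  ∈σ⁺ : ∀ {P Q} k → Q ∈ P → child k Q ∈ σ p P
  ∈σ⁺ k Q∈ = ∈-concatMap⁺ (σTile p) (lose Q∈ (∈σTile⁺ k _))

  child-place-injective : ∀ {k k'} Q Q' → place (child k Q) ≡ place (child k' Q') → k ≡ k' × place Q ≡ place Q'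
  child-place-injective {k} {k'} (tile o (i , j) _) (tile o' (i' , j') _) e
    with appendBit-injective {i} {i'} (cong (proj₁ ∘ proj₂) e) | appendBit-injective {j} {j'} (cong (proj₂ ∘ proj₂) e)
  ... | refl , δ₁≡ | refl , δ₂≡ = cong proj₂ same , cong₂ _,_ (cong proj₁ same) refl
    where
    same : (o , k) ≡ (o' , k')
    same = begin
      (o , k)                         ≡⟨ sym (childShape⁻¹-childShape o k) ⟩
      childShape⁻¹ (childShape o k)   ≡⟨ cong childShape⁻¹ (cong₂ _,_ (cong proj₁ e) (cong₂ _,_ δ₁≡ δ₂≡)) ⟩
      childShape⁻¹ (childShape o' k') ≡⟨ childShape⁻¹-childShape o' k' ⟩
      (o' , k')                       ∎
      where open ≡-Reasoning

  child-translate : ∀ k x Q → child k (translate x Q) ≡ translate (double x) (child k Q)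
  child-translate k (a , a') (tile o (i , j) d) =
    cong (λ q → tile (childOrient o k) q (childDeco k d))
      (cong₂ _,_ (appendBit-+ i a (proj₁ (childOffset o k))) (appendBit-+ j a' (proj₂ (childOffset o k))))

  UniquePlaces : Patch p → Set
  UniquePlaces P = ∀ {t t'} → t ∈ P → t' ∈ P → place t ≡ place t' → t ≡ t'

  σ-uniquePlaces : ∀ {P} → UniquePlaces P → UniquePlaces (σ p P)
  σ-uniquePlaces unique t∈ t'∈ e with ∈σ⁻ t∈ | ∈σ⁻ t'∈
  ... | Q , k , Q∈ , refl | Q' , k' , Q'∈ , refl with child-place-injective Q Q' e
  ... | refl , eQ = cong (child k) (unique Q∈ Q'∈ eQ)

  -- The tile of hex y c at a given place (with a junk value at every other place).
  hexTileAt : 𝔽 p → 𝔽 p → Orient × ℤ × ℤ → Tile p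
  hexTileAt y c (up   , + 0      , + 0)      = △ (+ 0) (+ 0) c y y
  hexTileAt y c (up   , -[1+ 0 ] , + 0)      = △ (ℤ.- + 1) (+ 0) y c y
  hexTileAt y c (up   , + 0      , -[1+ 0 ]) = △ (+ 0) (ℤ.- + 1) y y c
  hexTileAt y c (down , -[1+ 0 ] , + 0)      = ▽ (ℤ.- + 1) (+ 0) y y c
  hexTileAt y c (down , -[1+ 0 ] , -[1+ 0 ]) = ▽ (ℤ.- + 1) (ℤ.- + 1) c y y
  hexTileAt y c (down , + 0      , -[1+ 0 ]) = ▽ (+ 0) (ℤ.- + 1) y c y
  hexTileAt y c _                            = △ (+ 0) (+ 0) c y y

  hex-tileAt : ∀ {y c t} → t ∈ hex p y c → t ≡ hexTileAt y c (place t)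
  hex-tileAt (here refl)                                     = refl
  hex-tileAt (there (here refl))                             = refl
  hex-tileAt (there (there (here refl)))                     = refl
  hex-tileAt (there (there (there (here refl))))             = refl
  hex-tileAt (there (there (there (there (here refl)))))     = refl
  hex-tileAt (there (there (there (there (there (here refl)))))) = refl

  hex-uniquePlaces : ∀ {y c} → UniquePlaces (hex p y c)
  hex-uniquePlaces t∈ t'∈ e = trans (hex-tileAt t∈) (trans (cong (hexTileAt _ _) e) (sym (hex-tileAt t'∈)))

  σ^-uniquePlaces : ∀ m {P} → UniquePlaces P → UniquePlaces (σ^ p m P)
  σ^-uniquePlaces zero    unique = unique
  σ^-uniquePlaces (suc m) unique = σ-uniquePlaces (σ^-uniquePlaces m unique)

  σ^-mono : ∀ m {P P'} → P ⊆ P' → σ^ p m P ⊆ σ^ p m P'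
  σ^-mono zero    P⊆P' = P⊆P'
  σ^-mono (suc m) P⊆P' = concatMap⁺ (σTile p) (σ^-mono m P⊆P')

  σ^-+ : ∀ m n P → σ^ p (m ℕ.+ n) P ≡ σ^ p m (σ^ p n P)
  σ^-+ zero    n P = refl
  σ^-+ (suc m) n P = cong (σ p) (σ^-+ m n P)

  -- Each tile of the hexagon has a child at its own place.
  hex-⊆-σ : ∀ {y c} → hex p (c +ₚ y) c ⊆ σ p (hex p y c)
  hex-⊆-σ {y} {c} (here refl) = ∈σ⁺ {hex p y c} corner₁ (here refl)
  hex-⊆-σ {y} {c} (there (here refl)) =
    subst (_∈ σ p (hex p y c)) (cong (λ z → △ (ℤ.- + 1) (+ 0) z c (c +ₚ y)) (+ₚ-comm y c))
      (∈σ⁺ {hex p y c} corner₂ (there (here refl)))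
  hex-⊆-σ {y} {c} (there (there (here refl))) =
    subst (_∈ σ p (hex p y c)) (cong (λ z → △ (+ 0) (ℤ.- + 1) z z c) (+ₚ-comm y c))
      (∈σ⁺ {hex p y c} corner₃ (there (there (here refl))))
  hex-⊆-σ {y} {c} (there (there (there (here refl)))) =
    subst (_∈ σ p (hex p y c)) (cong (λ z → ▽ (ℤ.- + 1) (+ 0) z z c) (+ₚ-comm y c))
      (∈σ⁺ {hex p y c} corner₃ (there (there (there (here refl)))))
  hex-⊆-σ {y} {c} (there (there (there (there (here refl))))) =
    ∈σ⁺ {hex p y c} corner₁ (there (there (there (there (here refl)))))
  hex-⊆-σ {y} {c} (there (there (there (there (there (here refl)))))) =
    subst (_∈ σ p (hex p y c)) (cong (λ z → ▽ (+ 0) (ℤ.- + 1) z c (c +ₚ y)) (+ₚ-comm y c))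
      (∈σ⁺ {hex p y c} corner₂ (there (there (there (there (there (here refl)))))))

  module Hexagon (b c : 𝔽 p) where

    rim : ℕ → 𝔽 p
    rim zero    = b
    rim (suc m) = c +ₚ rim m

    iteratedHex : ℕ → Patch p
    iteratedHex m = σ^ p m (hex p b c)

    hex-⊆-iteratedHex : ∀ m → hex p (rim m) c ⊆ iteratedHex m
    hex-⊆-iteratedHex zero    = id
    hex-⊆-iteratedHex (suc m) = concatMap⁺ (σTile p) (hex-⊆-iteratedHex m) ∘ hex-⊆-σ

    rim-sound : ∀ m → + p ∣ ⟦ rim m ⟧ ℤ.- (⟦ b ⟧ ℤ.+ + m ℤ.* ⟦ c ⟧)
    rim-sound zero    = divides (+ 0) (lemma ⟦ b ⟧ ⟦ c ⟧ (+ p))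
      where lemma : ∀ b c p → b ℤ.- (b ℤ.+ + 0 ℤ.* c) ≡ + 0 ℤ.* p
            lemma = solve-∀
    rim-sound (suc m) = subst (+ p ∣_) (lemma ⟦ rim m ⟧ ⟦ c ⟧ ⟦ c +ₚ rim m ⟧ ⟦ b ⟧ (+ m))
      (∣m∣n⇒∣m+n (rim-sound m) (∣m⇒∣-m (+ₚ-sound c (rim m))))
      where lemma : ∀ r c s b m → r ℤ.- (b ℤ.+ m ℤ.* c) ℤ.+ ℤ.- (c ℤ.+ r ℤ.- s) ≡ s ℤ.- (b ℤ.+ (+ 1 ℤ.+ m) ℤ.* c)
            lemma = solve-∀

    rim-periodic : rim p ≡ b
    rim-periodic = residue-injective (subst (+ p ∣_) (lemma ⟦ rim p ⟧ ⟦ b ⟧ ⟦ c ⟧ (+ p))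
      (∣m∣n⇒∣m+n (rim-sound p) (∣n⇒∣m*n ⟦ c ⟧ (divides (+ 1) (sym (ℤ.*-identityˡ (+ p)))))))
      where lemma : ∀ r b c p → r ℤ.- (b ℤ.+ p ℤ.* c) ℤ.+ c ℤ.* p ≡ r ℤ.- b
            lemma = solve-∀

    iteratedHex-⊆-+p : ∀ m → iteratedHex m ⊆ iteratedHex (m ℕ.+ p)
    iteratedHex-⊆-+p m {t} t∈ = subst (t ∈_) (sym (σ^-+ m p (hex p b c)))
      (σ^-mono m (hex-⊆-iteratedHex p ∘ subst (λ y → _ ∈ hex p y c) (sym rim-periodic)) t∈)

    iteratedHex-⊆ : ∀ m k → iteratedHex m ⊆ iteratedHex (m ℕ.+ k ℕ.* p)
    iteratedHex-⊆ m zero    {t} t∈ = subst (λ n → t ∈ iteratedHex n) (sym (ℕ.+-identityʳ m)) t∈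
    iteratedHex-⊆ m (suc k) {t} t∈ = subst (λ n → t ∈ iteratedHex n) (ℕ.+-assoc m p (k ℕ.* p))
      (iteratedHex-⊆ (m ℕ.+ p) k (iteratedHex-⊆-+p m t∈))

    iteratedHex-uniquePlaces : ∀ m → UniquePlaces (iteratedHex m)
    iteratedHex-uniquePlaces m = σ^-uniquePlaces m hex-uniquePlaces

    -- The n-fold deflation σ⁻ⁿ(H_{b,c}): the union of the patches σᵐ(h_{b,c}) with m ≡ -n (mod p),
    -- which are nested because h_{b,c} ⊆ σᵖ(h_{b,c}).
    Deflated : ℕ → Tile p → Set
    Deflated n t = ∃₂ λ m k → m ℕ.+ n ≡ k ℕ.* p × t ∈ iteratedHex m

    Deflated-child : ∀ {n Q} k → Deflated (suc n) Q → Deflated n (child k Q)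
    Deflated-child {n} k (m , l , e , Q∈) = suc m , l , trans (sym (ℕ.+-suc m n)) e , ∈σ⁺ k Q∈

    Deflated-parent : ∀ {n t} → Deflated n t → ∃₂ λ Q k → Deflated (suc n) Q × t ≡ child k Q
    Deflated-parent {n} {t} (m , l , e , t∈) with ∈σ⁻ (subst (λ m → t ∈ iteratedHex m) m+p≡ (iteratedHex-⊆-+p m t∈))
      where
      m+p≡ : m ℕ.+ p ≡ suc (m ℕ.+ ℕ.pred p)
      m+p≡ = trans (cong (m ℕ.+_) (sym (ℕ.suc-pred p))) (ℕ.+-suc m (ℕ.pred p))
    ... | Q , k , Q∈ , t≡ = Q , k , (m ℕ.+ ℕ.pred p , suc l , e' , Q∈) , t≡
      where
      open ≡-Reasoning
      e' : m ℕ.+ ℕ.pred p ℕ.+ suc n ≡ suc l ℕ.* p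
      e' = begin
        m ℕ.+ ℕ.pred p ℕ.+ suc n   ≡⟨ ℕ.+-suc (m ℕ.+ ℕ.pred p) n ⟩
        suc (m ℕ.+ ℕ.pred p) ℕ.+ n ≡⟨ cong (ℕ._+ n) (sym (ℕ.+-suc m (ℕ.pred p))) ⟩
        m ℕ.+ suc (ℕ.pred p) ℕ.+ n ≡⟨ cong (λ q → m ℕ.+ q ℕ.+ n) (ℕ.suc-pred p) ⟩
        m ℕ.+ p ℕ.+ n              ≡⟨ ℕ.+-assoc m p n ⟩
        m ℕ.+ (p ℕ.+ n)            ≡⟨ cong (m ℕ.+_) (ℕ.+-comm p n) ⟩
        m ℕ.+ (n ℕ.+ p)            ≡⟨ sym (ℕ.+-assoc m n p) ⟩
        m ℕ.+ n ℕ.+ p              ≡⟨ cong (ℕ._+ p) e ⟩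
        l ℕ.* p ℕ.+ p              ≡⟨ ℕ.+-comm (l ℕ.* p) p ⟩
        suc l ℕ.* p                ∎

    Deflated-unique : ∀ {n t t'} → Deflated n t → Deflated n t' → place t ≡ place t' → t ≡ t'
    Deflated-unique {n} {t} {t'} (m , l , e , t∈) (m' , l' , e' , t'∈) =
      iteratedHex-uniquePlaces (m ℕ.+ l' ℕ.* p) (iteratedHex-⊆ m l' t∈)
        (subst (λ m → t' ∈ iteratedHex m) (sym common) (iteratedHex-⊆ m' l t'∈))
      where
      open ≡-Reasoning
      common : m ℕ.+ l' ℕ.* p ≡ m' ℕ.+ l ℕ.* p
      common = begin
        m ℕ.+ l' ℕ.* p      ≡⟨ cong (m ℕ.+_) (sym e') ⟩
        m ℕ.+ (m' ℕ.+ n)    ≡⟨ sym (ℕ.+-assoc m m' n) ⟩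
        m ℕ.+ m' ℕ.+ n      ≡⟨ cong (ℕ._+ n) (ℕ.+-comm m m') ⟩
        m' ℕ.+ m ℕ.+ n      ≡⟨ ℕ.+-assoc m' m n ⟩
        m' ℕ.+ (m ℕ.+ n)    ≡⟨ cong (m' ℕ.+_) e ⟩
        m' ℕ.+ l ℕ.* p      ∎

    -- The decoration of the six neighbours of the origin in σ⁻ⁿ(H_{b,c}).
    levelRim : ℕ → 𝔽 p
    levelRim n = rim (n ℕ.* ℕ.pred p)

    levelRim-index : ∀ n → n ℕ.* ℕ.pred p ℕ.+ n ≡ n ℕ.* p
    levelRim-index n = trans (ℕ.+-comm (n ℕ.* ℕ.pred p) n)
      (trans (sym (ℕ.*-suc n (ℕ.pred p))) (cong (n ℕ.*_) (ℕ.suc-pred p)))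

    Deflated-hex : ∀ n {t} → t ∈ hex p (levelRim n) c → Deflated n t
    Deflated-hex n t∈ = n ℕ.* ℕ.pred p , n , levelRim-index n , hex-⊆-iteratedHex (n ℕ.* ℕ.pred p) t∈

    levelRim-sound : ∀ n → + p ∣ ⟦ levelRim n ⟧ ℤ.+ + n ℤ.* ⟦ c ⟧ ℤ.- ⟦ b ⟧
    levelRim-sound n = subst (+ p ∣_) (lemma ⟦ levelRim n ⟧ ⟦ b ⟧ ⟦ c ⟧ (+ (n ℕ.* ℕ.pred p)) (+ n))
      (∣m∣n⇒∣m+n (rim-sound (n ℕ.* ℕ.pred p)) (∣m⇒∣m*n ⟦ c ⟧ p∣m+n))
      where
      lemma : ∀ r b c m n → r ℤ.- (b ℤ.+ m ℤ.* c) ℤ.+ (m ℤ.+ n) ℤ.* c ≡ r ℤ.+ n ℤ.* c ℤ.- b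
      lemma = solve-∀
      p∣m+n : + p ∣ + (n ℕ.* ℕ.pred p) ℤ.+ + n
      p∣m+n = divides (+ n) (trans (sym (ℤ.pos-+ (n ℕ.* ℕ.pred p) n))
                               (trans (cong +_ (levelRim-index n)) (ℤ.pos-* n p)))

    corner₁-deco-injective : ∀ {d d'} → childDeco corner₁ d ≡ childDeco corner₁ d' → d ≡ d'
    corner₁-deco-injective {x , _ , _} e with cong proj₁ e
    ... | refl = cong₂ _,_ refl (cong₂ _,_ (+ₚ-cancelˡ x (cong (proj₁ ∘ proj₂) e)) (+ₚ-cancelˡ x (cong (proj₂ ∘ proj₂) e)))

    Deflated-corner : ∀ {n Q} → Deflated n (child corner₁ Q) → Deflated (suc n) Q
    Deflated-corner {n} {Q} D = recognize (Deflated-parent D)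
      where
      recognize : (∃₂ λ Q' k → Deflated (suc n) Q' × child corner₁ Q ≡ child k Q') → Deflated (suc n) Q
      recognize (Q' , k , DQ' , e) = subst (Deflated (suc n)) (sym Q≡Q') DQ'
        where
        Q≡Q' : Q ≡ Q'
        Q≡Q' with child-place-injective Q Q' (cong place e)
        ... | refl , same-place = tile-≡ same-place (corner₁-deco-injective (cong Tile.deco e))

    ∈H⇒Deflated : ∀ {t} → _∈H[_,_] p t b c → Deflated 0 t
    ∈H⇒Deflated (k , t∈) = k ℕ.* p , k , ℕ.+-identityʳ (k ℕ.* p) , t∈

    Deflated⇒∈H : ∀ {t} → Deflated 0 t → _∈H[_,_] p t b c
    Deflated⇒∈H {t} (m , k , e , t∈) = k , subst (λ m → t ∈ iteratedHex m) (trans (sym (ℕ.+-identityʳ m)) e) t∈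

    Period : ℕ → ℤ × ℤ → Set
    Period n x = ∀ {t} → Deflated n t → Deflated n (translate x t)

    Period-half : ∀ {n x} → Period n (double x) → Period (suc n) x
    Period-half {x = x} per {Q} DQ =
      Deflated-corner (subst (Deflated _) (sym (child-translate corner₁ x Q)) (per (Deflated-child corner₁ DQ)))

    Period-double : ∀ {n x} → Period n x → Period n (double x)
    Period-double {x = x} per {t} Dt = subst (Deflated _) (translate-twice x t) (per (per Dt))

    Period-suc : ∀ {n x} → Period n x → Period (suc n) x
    Period-suc = Period-half ∘ Period-double

    -- t moved by x is a child of a tile at place (o , q), and a sibling moved back by x is s;
    -- d₀ is a dummy decoration that only serves to name child places.
    period-siblings : ∀ {n x t s k k' o q d₀} → Period n x → Period n (neg x) → Deflated n t → Deflated n s →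
      place (translate x t) ≡ place (child k (tile o q d₀)) →
      place (translate (neg x) (child k' (tile o q d₀))) ≡ place s →
      ∃ λ d → Tile.deco t ≡ childDeco k d × Tile.deco s ≡ childDeco k' d
    period-siblings {n} {x} {t} {s} {k} {k'} {o} {q} {d₀} per per⁻ Dt Ds e₁ e₂ = siblings (Deflated-parent (per Dt))
      where
      siblings : (∃₂ λ Q k₁ → Deflated (suc n) Q × translate x t ≡ child k₁ Q) →
                 ∃ λ d → Tile.deco t ≡ childDeco k d × Tile.deco s ≡ childDeco k' d
      siblings (Q , k₁ , DQ , t+x≡) = Tile.deco Q , deco-t , cong Tile.deco (sym sibling≡s)
        where
        shape : k₁ ≡ k × place Q ≡ (o , q)
        shape = child-place-injective Q (tile o q d₀) (trans (sym (cong place t+x≡)) e₁)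
        deco-t : Tile.deco t ≡ childDeco k (Tile.deco Q)
        deco-t = trans (cong Tile.deco t+x≡) (cong (λ k → childDeco k (Tile.deco Q)) (proj₁ shape))
        Q≡ : Q ≡ tile o q (Tile.deco Q)
        Q≡ = tile-≡ (proj₂ shape) refl
        sibling≡s : translate (neg x) (child k' Q) ≡ s
        sibling≡s = Deflated-unique (per⁻ (Deflated-child k' DQ)) Ds
          (trans (cong (λ Q → place (translate (neg x) (child k' Q))) Q≡) e₂)

    -- An odd period moves a rim tile of the central hexagon onto a tile whose parent also has a child
    -- moved back onto the central hexagon; reading off the shared decorations gives c = r + r.
    odd-period⇒ : ∀ {n u v δ δ'} → (δ , δ') ≢ (false , false) →
      Period n (appendBit u δ , appendBit v δ') → Period n (neg (appendBit u δ , appendBit v δ')) →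
      c ≡ levelRim n +ₚ levelRim n
    odd-period⇒ {δ = false} {false} odd _ _ = ⊥-elim (odd refl)
    odd-period⇒ {n} {u} {v} {true} {false} _ per per⁻ =
      case period-siblings {k = corner₁} {corner₂} {up} {u , v} {b , b , b} per per⁻
             (Deflated-hex n (there (here refl))) (Deflated-hex n (here refl))
             (cong (up ,_) (cong₂ _,_ (-1+odd u) (ℤ.+-identityˡ (appendBit v false))))
             (cong (up ,_) (cong₂ _,_ (ℤ.+-inverseʳ (appendBit u true)) (ℤ.+-inverseʳ (appendBit v false)))) of λ where
        (_ , e , e') → trans (cong (proj₁ ∘ proj₂) e) (sym (cong₂ _+ₚ_ (cong proj₁ e) (cong (proj₁ ∘ proj₂) e')))
    odd-period⇒ {n} {u} {v} {false} {true} _ per per⁻ =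
      case period-siblings {k = corner₁} {corner₃} {up} {u , v} {b , b , b} per per⁻
             (Deflated-hex n (there (there (here refl)))) (Deflated-hex n (here refl))
             (cong (up ,_) (cong₂ _,_ (ℤ.+-identityˡ (appendBit u false)) (-1+odd v)))
             (cong (up ,_) (cong₂ _,_ (ℤ.+-inverseʳ (appendBit u false)) (ℤ.+-inverseʳ (appendBit v true)))) of λ where
        (_ , e , e') → trans (cong (proj₂ ∘ proj₂) e) (sym (cong₂ _+ₚ_ (cong proj₁ e) (cong (proj₂ ∘ proj₂) e')))
    odd-period⇒ {n} {u} {v} {true} {true} _ per per⁻ =
      case period-siblings {k = corner₂} {corner₃} {down} {u , v} {b , b , b} per per⁻
             (Deflated-hex n (there (there (there (here refl)))))
             (Deflated-hex n (there (there (there (there (there (here refl)))))))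
             (cong (down ,_) (cong₂ _,_ (-1+odd u) (ℤ.+-identityˡ (appendBit v true))))
             (cong (down ,_) (cong₂ _,_ (ℤ.+-inverseʳ (appendBit u true)) (even-odd v))) of λ where
        (_ , e , e') → trans (cong (proj₂ ∘ proj₂) e) (sym (cong₂ _+ₚ_ (cong (proj₁ ∘ proj₂) e) (cong (proj₂ ∘ proj₂) e')))

    two-levels⇒p∣2c : ∀ {n} → c ≡ levelRim n +ₚ levelRim n → c ≡ levelRim (suc n) +ₚ levelRim (suc n) →
      + p ∣ + 2 ℤ.* ⟦ c ⟧
    two-levels⇒p∣2c {n} e e' = subst (+ p ∣_) (lemma ⟦ levelRim n ⟧ ⟦ levelRim (suc n) ⟧ ⟦ b ⟧ ⟦ c ⟧ (+ n))
      (∣m∣n⇒∣m+n (∣m∣n⇒∣m+n (∣m∣n⇒∣m+n (∣n⇒∣m*n (+ 2) (levelRim-sound (suc n)))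
                                       (∣m⇒∣-m (∣n⇒∣m*n (+ 2) (levelRim-sound n))))
                            (twice (levelRim n) e))
                 (∣m⇒∣-m (twice (levelRim (suc n)) e')))
      where
      twice : ∀ r → c ≡ r +ₚ r → + p ∣ ⟦ r ⟧ ℤ.+ ⟦ r ⟧ ℤ.- ⟦ c ⟧
      twice r e = subst (λ s → + p ∣ ⟦ r ⟧ ℤ.+ ⟦ r ⟧ ℤ.- ⟦ s ⟧) (sym e) (+ₚ-sound r r)
      lemma : ∀ r r' b c n → + 2 ℤ.* (r' ℤ.+ (+ 1 ℤ.+ n) ℤ.* c ℤ.- b) ℤ.+ ℤ.- (+ 2 ℤ.* (r ℤ.+ n ℤ.* c ℤ.- b))
                             ℤ.+ (r ℤ.+ r ℤ.- c) ℤ.+ ℤ.- (r' ℤ.+ r' ℤ.- c) ≡ + 2 ℤ.* c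
      lemma = solve-∀

    odd-period-impossible : Prime p → p ≢ 2 → toℕ c ≢ 0 → ∀ {m u v δ δ'} → (δ , δ') ≢ (false , false) →
      Period m (appendBit u δ , appendBit v δ') → Period m (neg (appendBit u δ , appendBit v δ')) → ⊥
    odd-period-impossible p-prime p≢2 c≢0 {m} {u} {v} {δ} {δ'} odd per per⁻ =
      odd-prime∤2x p-prime p≢2 c c≢0 (two-levels⇒p∣2c {m}
        (odd-period⇒ {m} {u} {v} {δ} {δ'} odd per per⁻)
        (odd-period⇒ {suc m} {u} {v} {δ} {δ'} odd (Period-suc per) (Period-suc per⁻)))

    no-period : (∀ {m u v δ δ'} → (δ , δ') ≢ (false , false) →
                  Period m (appendBit u δ , appendBit v δ') → Period m (neg (appendBit u δ , appendBit v δ')) → ⊥) →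
                ∀ {n} x → Acc ℕ._<_ (size x) → x ≢ (+ 0 , + 0) → Period n x → Period n (neg x) → ⊥
    no-period no-odd (x₁ , x₂) (acc smaller) x≢0 per per⁻
      with appendBit-surjective x₁ | appendBit-surjective x₂
    ... | u , false , refl | v , false , refl =
      no-period no-odd (u , v) (smaller (size-<-double (x≢0 ∘ cong double))) (x≢0 ∘ cong double)
        (Period-half per) (Period-half (subst (Period _) (neg-double (u , v)) per⁻))
    ... | u , true  , refl | v , δ'    , refl = no-odd {u = u} {v} {true} {δ'} (λ ()) per per⁻
    ... | u , false , refl | v , true  , refl = no-odd {u = u} {v} {false} {true} (λ ()) per per⁻

    invariance⇒periods : ∀ x → (∀ t → (_∈H[_,_] p t b c → _∈H[_,_] p (translate x t) b c)
                                    × (_∈H[_,_] p (translate x t) b c → _∈H[_,_] p t b c)) →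
                         Period 0 x × Period 0 (neg x)
    invariance⇒periods x invariant =
      (λ {t} Dt → ∈H⇒Deflated (proj₁ (invariant t) (Deflated⇒∈H Dt))) ,
      (λ {t} Dt → ∈H⇒Deflated (proj₂ (invariant (translate (neg x) t))
                    (subst (λ t → _∈H[_,_] p t b c) (sym (translate-neg x t)) (Deflated⇒∈H Dt))))

mainTheorem6 : (p : ℕ) .{{_ : NonZero p}} → Prime p → p ≢ 2 →
    (b c : 𝔽 p) → toℕ c ≢ 0 →
    (x : ℤ × ℤ) → x ≢ (+ 0 , + 0) →
    ¬ (∀ (t : Tile p) → (_∈H[_,_] p t b c → _∈H[_,_] p (translate x t) b c)
                       × (_∈H[_,_] p (translate x t) b c → _∈H[_,_] p t b c))
mainTheorem6 p p-prime p≢2 b c c≢0 x x≢0 invariant =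
  no-period (odd-period-impossible p-prime p≢2 c≢0) x (<-wellFounded (size x)) x≢0
    (proj₁ (invariance⇒periods x invariant)) (proj₂ (invariance⇒periods x invariant))
  where
  open Substitution p
  open Hexagon b c
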